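{- There is a computable reduction from Problem C to Problem D, where: Problem C: given variables $Q=\{q_1,\dots,q_n\}$, $P=\{p_1,\dots,p_n\}$ and a finite set of equations each of one of the forms (a) $\sum_{i\in I}\alpha_iq_i=0$ ($I\subseteq\{1,\dots,n\}$, $\alpha_i\in\mathbb{Q}$); (b) $q_ip_j=q_kp_\ell$; (c) $q_i=\frac12\sum_{j=1}^nq_j$; (d) $p_i=\frac12\sum_{j=1}^np_j$; decide whether there is a rational solution with $q_1\le q_i$ and $q_i,p_i\ge1$ for $i=1,\dots,n$, and $\sum_ip_i=\sum_iq_i$. Problem D: given variables $Q=\{q_1,\dots,q_n\}$, $P=\{p_1,\dots,p_n\}$ and a finite set of constraints each of one of the forms (a) $\sum_{i\in I}\alpha_iq_i\le0$; (b) $\sum_{i\in I}\alpha_ip_i\le0$ (for $I\subseteq\{1,\dots,n\}$, $\alpha_i\in\mathbb{Q}$); (c) $q_ip_j=q_kp_\ell$ ($i,j,k,\ell\in\{1,\dots,n\}$); decide whether there is a rational solution with $q_i>0$ and $p_i>0$ for all $i=1,\dots,n$.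
   Context: A computable reduction from one problem to another is an algorithm transforming each instance of the first problem into an instance of the second such that the first has a solution if and only if the second does. -}

module Defs where

open import Data.Nat using (ℕ; zero; suc)
open import Data.Fin using (Fin; zero; suc)
open import Data.Vec using (Vec; lookup)
open import Data.List using (List)
open import Data.List.Relation.Unary.All using (All)
open import Data.Product using (Σ; ∃; ∃-syntax; _×_)
open import Data.Rational using (ℚ; 0ℚ; 1ℚ; ½; _+_; _*_; _≤_; _<_)
open import Relation.Binary.PropositionalEquality using (_≡_)

sumℚ : ∀ {n} → (Fin n → ℚ) → ℚ
sumℚ {zero}  f = 0ℚ
sumℚ {suc n} f = f zero + sumℚ (λ i → f (suc i))

-- Linear form  Σ_{i∈I} α_i x_i ; a subset I with coefficients α_i is encoded
-- as a coefficient vector (α_i = 0 for i ∉ I).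
linForm : ∀ {n} → Vec ℚ n → (Fin n → ℚ) → ℚ
linForm α x = sumℚ (λ i → lookup α i * x i)

data EqC (n : ℕ) : Set where
  linQ  : Vec ℚ n → EqC n
  prod  : Fin n → Fin n → Fin n → Fin n → EqC n
  halfQ : Fin n → EqC n
  halfP : Fin n → EqC n

satC : ∀ {n} → (Fin n → ℚ) → (Fin n → ℚ) → EqC n → Set
satC q p (linQ α)       = linForm α q ≡ 0ℚ
satC q p (prod i j k l) = q i * p j ≡ q k * p l
satC q p (halfQ i)      = q i ≡ ½ * sumℚ q
satC q p (halfP i)      = p i ≡ ½ * sumℚ p

-- An instance of Problem C: n ≥ 1 variables q_1..q_n, p_1..p_n
-- (stored as n = suc m so that q_1 exists) and a finite list of equations.
record InstC : Set where
  constructor instC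
  field
    m   : ℕ
    eqs : List (EqC (suc m))

SolvableC : InstC → Set
SolvableC (instC m eqs) =
  ∃[ q ] ∃[ p ] (All (satC q p) eqs
    × (∀ i → q zero ≤ q i)
    × (∀ i → 1ℚ ≤ q i × 1ℚ ≤ p i)
    × sumℚ p ≡ sumℚ q)

data ConD (n : ℕ) : Set where
  leQ  : Vec ℚ n → ConD n
  leP  : Vec ℚ n → ConD n
  prod : Fin n → Fin n → Fin n → Fin n → ConD n

satD : ∀ {n} → (Fin n → ℚ) → (Fin n → ℚ) → ConD n → Set
satD q p (leQ α)        = linForm α q ≤ 0ℚ
satD q p (leP α)        = linForm α p ≤ 0ℚ
satD q p (prod i j k l) = q i * p j ≡ q k * p l

record InstD : Set where
  constructor instD
  field
    n    : ℕ
    cons : List (ConD n)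

SolvableD : InstD → Set
SolvableD (instD n cons) =
  ∃[ q ] ∃[ p ] (All (satD q p) cons × (∀ i → 0ℚ < q i × 0ℚ < p i))

-- Every equation of Problem C is linear homogeneous in q or in p, or bihomogeneous,
-- so the solution set of C-equations is closed under q ↦ a q, p ↦ b p with a, b ≥ 0.
-- Turning each linear equation into two inequalities and adding the inequalities
-- q₁ - qᵢ ≤ 0 gives an instance of D. A rational solution with q, p ≥ 1 is in
-- particular positive; conversely a positive solution can be rescaled by
-- a = t Σp, b = t Σq, which makes Σ(a q) = Σ(b p) and, for t large, all entries ≥ 1.
module Submission where

open import Defs
open import Data.Product using (Σ)
open import Function.Bundles using (_⇔_)

open import Algebra.Bundles using (CommutativeMonoid)
import Algebra.Properties.CommutativeSemigroup as CommSemigroupProperties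
open import Data.Fin using (Fin; zero; suc)
open import Data.List using (List; []; _∷_; _++_; concatMap; tabulate)
open import Data.List.Relation.Unary.All using (All; []; _∷_)
import Data.List.Relation.Unary.All as All
open import Data.List.Relation.Unary.All.Properties
  using (++⁺; ++⁻; concat⁺; concat⁻; map⁺; map⁻; tabulate⁺; tabulate⁻)
open import Data.Nat using (zero; suc)
open import Data.Product using (∃-syntax; _×_; _,_; proj₁; proj₂)
open import Data.Rational
  using (ℚ; 0ℚ; 1ℚ; ½; _+_; _*_; _-_; -_; 1/_; _⊔_; _≤_; _<_;
         Positive; NonNegative; NonZero; positive; nonNegative)
open import Data.Rational.Properties
open import Data.Vec using (Vec; _∷_; lookup; map; replicate; zipWith)
open import Data.Vec.Properties using (lookup-map; lookup-replicate; lookup-zipWith)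
open import Function.Base using (_∘_)
open import Function.Bundles using (mk⇔; Equivalence)
open import Relation.Binary.PropositionalEquality
open import Algebra.Properties.Group +-0-group using (x∙y⁻¹≈ε⇒x≈y; x≈y⇒x∙y⁻¹≈ε)

open Equivalence using (to; from)

private
  module +-Props =
    CommSemigroupProperties (CommutativeMonoid.commutativeSemigroup +-0-commutativeMonoid)
  module *-Props =
    CommSemigroupProperties (CommutativeMonoid.commutativeSemigroup *-1-commutativeMonoid)

≡⇔-≡0 : ∀ {p q} → p ≡ q ⇔ p - q ≡ 0ℚ
≡⇔-≡0 {p} {q} = mk⇔ x≈y⇒x∙y⁻¹≈ε (x∙y⁻¹≈ε⇒x≈y p q)

-≤0⇔≤ : ∀ {p q} → p - q ≤ 0ℚ ⇔ p ≤ q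
-≤0⇔≤ {p} {q} = mk⇔ backward forward
  where
  forward : p ≤ q → p - q ≤ 0ℚ
  forward p≤q = subst (p - q ≤_) (+-inverseʳ q) (+-monoˡ-≤ (- q) p≤q)
  backward : p - q ≤ 0ℚ → p ≤ q
  backward p-q≤0 = subst₂ _≤_ p-q+q≡p (+-identityˡ q) (+-monoˡ-≤ q p-q≤0)
    where
    p-q+q≡p : p - q + q ≡ p
    p-q+q≡p = trans (+-assoc p (- q) q) (trans (cong (p +_) (+-inverseˡ q)) (+-identityʳ p))

≡0⇔≤0×-≤0 : ∀ {p} → p ≡ 0ℚ ⇔ (p ≤ 0ℚ × - p ≤ 0ℚ)
≡0⇔≤0×-≤0 {p} = mk⇔ (λ { refl → ≤-refl , ≤-refl }) backward
  where
  backward : p ≤ 0ℚ × - p ≤ 0ℚ → p ≡ 0ℚ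
  backward (p≤0 , -p≤0) =
    ≤-antisym p≤0 (subst₂ _≤_ (+-inverseˡ p) (+-identityˡ p) (+-monoˡ-≤ p -p≤0))

1≤⇒pos : ∀ {p} → 1ℚ ≤ p → 0ℚ < p
1≤⇒pos = <-≤-trans (positive⁻¹ 1ℚ)

*-pos : ∀ {p q} → 0ℚ < p → 0ℚ < q → 0ℚ < p * q
*-pos {p} {q} p>0 q>0 =
  positive⁻¹ (p * q) {{pos*pos⇒pos p {{positive p>0}} q {{positive q>0}}}}

sumℚ-cong : ∀ {n} {f g : Fin n → ℚ} → (∀ i → f i ≡ g i) → sumℚ f ≡ sumℚ g
sumℚ-cong {zero}  f≗g = refl
sumℚ-cong {suc n} f≗g = cong₂ _+_ (f≗g zero) (sumℚ-cong (f≗g ∘ suc))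

sumℚ-+ : ∀ {n} (f g : Fin n → ℚ) → sumℚ (λ i → f i + g i) ≡ sumℚ f + sumℚ g
sumℚ-+ {zero}  f g = refl
sumℚ-+ {suc n} f g = trans (cong (f zero + g zero +_) (sumℚ-+ (f ∘ suc) (g ∘ suc)))
                           (+-Props.interchange (f zero) (g zero) _ _)

sumℚ-neg : ∀ {n} (f : Fin n → ℚ) → sumℚ (λ i → - f i) ≡ - sumℚ f
sumℚ-neg {zero}  f = refl
sumℚ-neg {suc n} f = trans (cong (- f zero +_) (sumℚ-neg (f ∘ suc)))
                           (sym (neg-distrib-+ (f zero) (sumℚ (f ∘ suc))))

sumℚ-*ˡ : ∀ {n} c (f : Fin n → ℚ) → sumℚ (λ i → c * f i) ≡ c * sumℚ f
sumℚ-*ˡ {zero}  c f = sym (*-zeroʳ c)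
sumℚ-*ˡ {suc n} c f = trans (cong (c * f zero +_) (sumℚ-*ˡ c (f ∘ suc)))
                            (sym (*-distribˡ-+ c (f zero) (sumℚ (f ∘ suc))))

sumℚ-nonNeg : ∀ {n} (f : Fin n → ℚ) → (∀ i → 0ℚ ≤ f i) → 0ℚ ≤ sumℚ f
sumℚ-nonNeg {zero}  f f≥0 = ≤-refl
sumℚ-nonNeg {suc n} f f≥0 = +-mono-≤ (f≥0 zero) (sumℚ-nonNeg (f ∘ suc) (f≥0 ∘ suc))

sumℚ-pos : ∀ {n} (f : Fin (suc n) → ℚ) → (∀ i → 0ℚ < f i) → 0ℚ < sumℚ f
sumℚ-pos f f>0 = +-mono-<-≤ (f>0 zero) (sumℚ-nonNeg (f ∘ suc) (<⇒≤ ∘ f>0 ∘ suc))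

scale : ∀ {n} → ℚ → (Fin n → ℚ) → Fin n → ℚ
scale c x i = c * x i

basis : ∀ {n} → Fin n → Vec ℚ n
basis zero    = 1ℚ ∷ replicate _ 0ℚ
basis (suc i) = 0ℚ ∷ basis i

negate : ∀ {n} → Vec ℚ n → Vec ℚ n
negate = map (-_)

_⊖_ : ∀ {n} → Vec ℚ n → Vec ℚ n → Vec ℚ n
_⊖_ = zipWith _-_

module _ {n} (x : Fin n → ℚ) where

  linForm-replicate : ∀ c → linForm (replicate n c) x ≡ c * sumℚ x
  linForm-replicate c =
    trans (sumℚ-cong (λ i → cong (_* x i) (lookup-replicate i c))) (sumℚ-*ˡ c x)

  linForm-negate : ∀ α → linForm (negate α) x ≡ - linForm α x
  linForm-negate α = trans (sumℚ-cong coeff) (sumℚ-neg (λ i → lookup α i * x i))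
    where
    coeff : ∀ i → lookup (negate α) i * x i ≡ - (lookup α i * x i)
    coeff i = trans (cong (_* x i) (lookup-map i (-_) α))
                    (sym (neg-distribˡ-* (lookup α i) (x i)))

  linForm-⊖ : ∀ α β → linForm (α ⊖ β) x ≡ linForm α x - linForm β x
  linForm-⊖ α β = begin
      linForm (α ⊖ β) x
    ≡⟨ sumℚ-cong coeff ⟩
      sumℚ (λ i → lookup α i * x i + - (lookup β i * x i))
    ≡⟨ sumℚ-+ (λ i → lookup α i * x i) (λ i → - (lookup β i * x i)) ⟩
      linForm α x + sumℚ (λ i → - (lookup β i * x i))
    ≡⟨ cong (linForm α x +_) (sumℚ-neg (λ i → lookup β i * x i)) ⟩
      linForm α x - linForm β x ∎
    where
    open ≡-Reasoning
    coeff : ∀ i → lookup (α ⊖ β) i * x i ≡ lookup α i * x i + - (lookup β i * x i)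
    coeff i = begin
        lookup (α ⊖ β) i * x i
      ≡⟨ cong (_* x i) (lookup-zipWith _-_ i α β) ⟩
        (lookup α i - lookup β i) * x i
      ≡⟨ *-distribʳ-+ (x i) (lookup α i) (- lookup β i) ⟩
        lookup α i * x i + - lookup β i * x i
      ≡⟨ cong (lookup α i * x i +_) (sym (neg-distribˡ-* (lookup β i) (x i))) ⟩
        lookup α i * x i + - (lookup β i * x i) ∎

linForm-scale : ∀ {n} (α : Vec ℚ n) c x → linForm α (scale c x) ≡ c * linForm α x
linForm-scale α c x =
  trans (sumℚ-cong (λ i → *-Props.x∙yz≈y∙xz (lookup α i) c (x i)))
        (sumℚ-*ˡ c (λ i → lookup α i * x i))

linForm-basis : ∀ {n} (i : Fin n) x → linForm (basis i) x ≡ x i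
linForm-basis zero    x = begin
    1ℚ * x zero + linForm (replicate _ 0ℚ) (x ∘ suc)
  ≡⟨ cong₂ _+_ (*-identityˡ (x zero)) (linForm-replicate (x ∘ suc) 0ℚ) ⟩
    x zero + 0ℚ * sumℚ (x ∘ suc)
  ≡⟨ cong (x zero +_) (*-zeroˡ (sumℚ (x ∘ suc))) ⟩
    x zero + 0ℚ
  ≡⟨ +-identityʳ (x zero) ⟩
    x zero ∎
  where open ≡-Reasoning
linForm-basis (suc i) x =
  trans (cong₂ _+_ (*-zeroˡ (x zero)) (linForm-basis i (x ∘ suc))) (+-identityˡ _)

linForm-basis-⊖ : ∀ {n} (i j : Fin n) x → linForm (basis i ⊖ basis j) x ≡ x i - x j
linForm-basis-⊖ i j x =
  trans (linForm-⊖ x (basis i) (basis j)) (cong₂ _-_ (linForm-basis i x) (linForm-basis j x))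

halfSum : ∀ {n} → Fin n → Vec ℚ n
halfSum i = basis i ⊖ replicate _ ½

linForm-halfSum : ∀ {n} (i : Fin n) x → linForm (halfSum i) x ≡ x i - ½ * sumℚ x
linForm-halfSum i x = trans (linForm-⊖ x (basis i) (replicate _ ½))
                            (cong₂ _-_ (linForm-basis i x) (linForm-replicate x ½))

linForm≡0⇔ : ∀ {n} (α : Vec ℚ n) x →
             linForm α x ≡ 0ℚ ⇔ (linForm α x ≤ 0ℚ × linForm (negate α) x ≤ 0ℚ)
linForm≡0⇔ α x rewrite linForm-negate x α = ≡0⇔≤0×-≤0

half⇔linForm≡0 : ∀ {n} (i : Fin n) x → x i ≡ ½ * sumℚ x ⇔ linForm (halfSum i) x ≡ 0ℚ
half⇔linForm≡0 i x rewrite linForm-halfSum i x = ≡⇔-≡0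

satC-scale : ∀ {n} a b {q p : Fin n → ℚ} {e} → satC q p e → satC (scale a q) (scale b p) e
satC-scale a b {q} {p} {linQ α} h =
  trans (linForm-scale α a q) (trans (cong (a *_) h) (*-zeroʳ a))
satC-scale a b {q} {p} {prod i j k l} h = begin
    a * q i * (b * p j)   ≡⟨ *-Props.interchange a (q i) b (p j) ⟩
    a * b * (q i * p j)   ≡⟨ cong (a * b *_) h ⟩
    a * b * (q k * p l)   ≡⟨ *-Props.interchange a b (q k) (p l) ⟩
    a * q k * (b * p l)   ∎
  where open ≡-Reasoning
satC-scale a b {q} {p} {halfQ i} h =
  trans (cong (a *_) h)
        (trans (*-Props.x∙yz≈y∙xz a ½ (sumℚ q)) (cong (½ *_) (sym (sumℚ-*ˡ a q))))
satC-scale a b {q} {p} {halfP i} h =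
  trans (cong (b *_) h)
        (trans (*-Props.x∙yz≈y∙xz b ½ (sumℚ p)) (cong (½ *_) (sym (sumℚ-*ˡ b p))))

-- The bound is upward closed so that bounds for two families combine by _⊔_.
scaleToAtLeast1 : ∀ {n} (x : Fin n → ℚ) → (∀ i → 0ℚ < x i) →
                  ∃[ c ] (0ℚ ≤ c × ∀ {d} → c ≤ d → ∀ i → 1ℚ ≤ d * x i)
scaleToAtLeast1 {zero}  x x>0 = 0ℚ , ≤-refl , λ _ ()
scaleToAtLeast1 {suc n} x x>0 with scaleToAtLeast1 (x ∘ suc) (x>0 ∘ suc)
... | c , 0≤c , c-bound = 1/ x zero ⊔ c , ≤-trans 0≤c (p≤q⊔p (1/ x zero) c) , bound
  where
  instance
    x₀-pos : Positive (x zero)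
    x₀-pos = positive (x>0 zero)
    x₀-nonNeg : NonNegative (x zero)
    x₀-nonNeg = pos⇒nonNeg (x zero)
    x₀-nonZero : NonZero (x zero)
    x₀-nonZero = pos⇒nonZero (x zero)

  bound : ∀ {d} → 1/ x zero ⊔ c ≤ d → ∀ i → 1ℚ ≤ d * x i
  bound {d} d≥ zero = subst (_≤ d * x zero) (*-inverseˡ (x zero))
                         (*-monoʳ-≤-nonNeg (x zero) (p⊔q≤r⇒p≤r (1/ x zero) c d≥))
  bound d≥ (suc i)   = c-bound (p⊔q≤r⇒q≤r (1/ x zero) c d≥) i

rescale-solvable : ∀ {m} {eqs : List (EqC (suc m))} (q p : Fin (suc m) → ℚ) →
                   All (satC q p) eqs → (∀ i → q zero ≤ q i) →
                   (∀ i → 0ℚ < q i) → (∀ i → 0ℚ < p i) → SolvableC (instC m eqs)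
rescale-solvable q p sat q₀-min q>0 p>0
  with scaleToAtLeast1 (λ i → sumℚ p * q i) (λ i → *-pos Σp>0 (q>0 i))
     | scaleToAtLeast1 (λ i → sumℚ q * p i) (λ i → *-pos Σq>0 (p>0 i))
  where
  Σq>0 = sumℚ-pos q q>0
  Σp>0 = sumℚ-pos p p>0
... | cq , 0≤cq , cq-bound | cp , _ , cp-bound =
  scale a q , scale b p , All.map (satC-scale a b) sat , min , atLeast1 , sums
  where
  t = cq ⊔ cp
  a = t * sumℚ p
  b = t * sumℚ q

  0≤a : 0ℚ ≤ a
  0≤a = subst (_≤ a) (*-zeroʳ t)
          (*-monoˡ-≤-nonNeg t {{nonNegative (≤-trans 0≤cq (p≤p⊔q cq cp))}}
            (sumℚ-nonNeg p (<⇒≤ ∘ p>0)))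

  min : ∀ i → a * q zero ≤ a * q i
  min i = *-monoˡ-≤-nonNeg a {{nonNegative 0≤a}} (q₀-min i)

  atLeast1 : ∀ i → 1ℚ ≤ a * q i × 1ℚ ≤ b * p i
  atLeast1 i = subst (1ℚ ≤_) (sym (*-assoc t (sumℚ p) (q i))) (cq-bound (p≤p⊔q cq cp) i)
             , subst (1ℚ ≤_) (sym (*-assoc t (sumℚ q) (p i))) (cp-bound (p≤q⊔p cq cp) i)

  sums : sumℚ (scale b p) ≡ sumℚ (scale a q)
  sums = trans (sumℚ-*ˡ b p)
        (trans (*-Props.xy∙z≈xz∙y t (sumℚ q) (sumℚ p)) (sym (sumℚ-*ˡ a q)))

toD : ∀ {n} → EqC n → List (ConD n)
toD (linQ α)       = leQ α ∷ leQ (negate α) ∷ []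
toD (prod i j k l) = prod i j k l ∷ []
toD (halfQ i)      = leQ (halfSum i) ∷ leQ (negate (halfSum i)) ∷ []
toD (halfP i)      = leP (halfSum i) ∷ leP (negate (halfSum i)) ∷ []

q₀≤ : ∀ {m} → Fin (suc m) → ConD (suc m)
q₀≤ i = leQ (basis zero ⊖ basis i)

q₀-minimal : ∀ m → List (ConD (suc m))
q₀-minimal m = tabulate q₀≤

reduce : InstC → InstD
reduce (instC m eqs) = instD (suc m) (concatMap toD eqs ++ q₀-minimal m)

module _ {n} (q p : Fin n → ℚ) where

  toD-sound : ∀ {e} → satC q p e → All (satD q p) (toD e)
  toD-sound {linQ α} h       = let (h₁ , h₂) = to (linForm≡0⇔ α q) h in h₁ ∷ h₂ ∷ []
  toD-sound {prod i j k l} h = h ∷ []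
  toD-sound {halfQ i} h      =
    let (h₁ , h₂) = to (linForm≡0⇔ (halfSum i) q) (to (half⇔linForm≡0 i q) h)
    in h₁ ∷ h₂ ∷ []
  toD-sound {halfP i} h      =
    let (h₁ , h₂) = to (linForm≡0⇔ (halfSum i) p) (to (half⇔linForm≡0 i p) h)
    in h₁ ∷ h₂ ∷ []

  toD-complete : ∀ {e} → All (satD q p) (toD e) → satC q p e
  toD-complete {linQ α}       (h₁ ∷ h₂ ∷ []) = from (linForm≡0⇔ α q) (h₁ , h₂)
  toD-complete {prod i j k l} (h ∷ [])       = h
  toD-complete {halfQ i}      (h₁ ∷ h₂ ∷ []) =
    from (half⇔linForm≡0 i q) (from (linForm≡0⇔ (halfSum i) q) (h₁ , h₂))
  toD-complete {halfP i}      (h₁ ∷ h₂ ∷ []) =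
    from (half⇔linForm≡0 i p) (from (linForm≡0⇔ (halfSum i) p) (h₁ , h₂))

satD-q₀≤⇔ : ∀ {m} (q p : Fin (suc m) → ℚ) i → satD q p (q₀≤ i) ⇔ q zero ≤ q i
satD-q₀≤⇔ q p i rewrite linForm-basis-⊖ zero i q = -≤0⇔≤

satD-q₀-minimal⇔ : ∀ {m} (q p : Fin (suc m) → ℚ) →
                   All (satD q p) (q₀-minimal m) ⇔ (∀ i → q zero ≤ q i)
satD-q₀-minimal⇔ q p = mk⇔
  (λ h i → to (satD-q₀≤⇔ q p i) (tabulate⁻ {f = q₀≤} h i))
  (λ h → tabulate⁺ {f = q₀≤} (λ i → from (satD-q₀≤⇔ q p i) (h i)))

satD-reduce⇔ : ∀ {m} (eqs : List (EqC (suc m))) q p →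
               All (satD q p) (concatMap toD eqs ++ q₀-minimal m) ⇔
               (All (satC q p) eqs × ∀ i → q zero ≤ q i)
satD-reduce⇔ eqs q p = mk⇔
  (λ h → let (hs , hmin) = ++⁻ (concatMap toD eqs) h in
         All.map (toD-complete q p) (map⁻ (concat⁻ hs)) , to (satD-q₀-minimal⇔ q p) hmin)
  (λ (hs , hmin) → ++⁺ (concat⁺ (map⁺ (All.map (toD-sound q p) hs)))
                       (from (satD-q₀-minimal⇔ q p) hmin))

lemma13 : Σ (InstC → InstD) (λ f → ∀ x → SolvableC x ⇔ SolvableD (f x))
lemma13 = reduce , λ { (instC m eqs) → mk⇔ (forward m eqs) (backward m eqs) }
  where
  forward : ∀ m eqs → SolvableC (instC m eqs) → SolvableD (reduce (instC m eqs))
  forward m eqs (q , p , sat , q₀-min , atLeast1 , _) =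
    q , p , from (satD-reduce⇔ eqs q p) (sat , q₀-min)
      , λ i → 1≤⇒pos (proj₁ (atLeast1 i)) , 1≤⇒pos (proj₂ (atLeast1 i))

  backward : ∀ m eqs → SolvableD (reduce (instC m eqs)) → SolvableC (instC m eqs)
  backward m eqs (q , p , satCons , q,p>0) =
    let (sat , q₀-min) = to (satD-reduce⇔ eqs q p) satCons in
    rescale-solvable q p sat q₀-min (proj₁ ∘ q,p>0) (proj₂ ∘ q,p>0)
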